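{- Let $v$ be a valuation on a field $K$, $V$ its valuation ring, $T\subseteq S\subseteq K$ and $\mathcal F\subseteq K[x]$. Consider the statements (1) for all $f\in\mathcal F$, $\min_{t\in T}v(f(t))=\min_{s\in S}v(f(s))$; (2) $T$ is $V$-polynomially dense in $S$ relative to $\mathcal F$. Then (1) implies (2). If $\mathcal F$ is closed under multiplication by non-zero constants of $K$, then (2) implies (1).
   Context: For a domain $D$ with quotient field $K$, $T\subseteq K$ and $\mathcal F\subseteq K[x]$, the $D$-polynomial closure of $T$ relative to $\mathcal F$ is $\{s\in K\mid \forall f\in\mathcal F\cap\operatorname{Int}(T,D):\ f(s)\in D\}$, where $\operatorname{Int}(T,D)=\{f\in K[x]\mid f(T)\subseteq D\}$. If $T\subseteq S\subseteq K$ and this closure contains $S$, then $T$ is called $D$-polynomially dense in $S$ relative to $\mathcal F$. Valuations are written additively with $v(0)=\infty$. -}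

module Defs where

open import Level using (0ℓ)
open import Data.Product using (Σ; ∃; _×_; _,_)
open import Data.Sum using (_⊎_)
open import Data.List using (List; []; _∷_; map)
open import Relation.Nullary using (¬_)
open import Relation.Binary.PropositionalEquality using (_≡_)
open import Algebra.Bundles using (CommutativeRing)
open import Function.Bundles using (_⇔_)

record Field : Set₁ where
  field
    commRing : CommutativeRing 0ℓ 0ℓ
  open CommutativeRing commRing public
  field
    0≉1     : ¬ (0# ≈ 1#)
    inverse : ∀ x → ¬ (x ≈ 0#) → ∃ λ y → (x * y) ≈ 1#

record OrderedAbelianGroup : Set₁ where
  infixl 6 _+_
  infix  4 _≤_
  field
    Carrier   : Set
    _+_       : Carrier → Carrier → Carrier
    0#        : Carrier
    -_        : Carrier → Carrier
    _≤_       : Carrier → Carrier → Set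
    +-assoc   : ∀ a b c → (a + b) + c ≡ a + (b + c)
    +-comm    : ∀ a b → a + b ≡ b + a
    +-identityˡ : ∀ a → 0# + a ≡ a
    -‿inverseˡ : ∀ a → (- a) + a ≡ 0#
    ≤-refl    : ∀ a → a ≤ a
    ≤-trans   : ∀ {a b c} → a ≤ b → b ≤ c → a ≤ c
    ≤-antisym : ∀ {a b} → a ≤ b → b ≤ a → a ≡ b
    ≤-total   : ∀ a b → (a ≤ b) ⊎ (b ≤ a)
    +-mono-≤  : ∀ {a b} c → a ≤ b → a + c ≤ b + c

module _ (G : OrderedAbelianGroup) where
  open OrderedAbelianGroup G

  data Γ∞ : Set where
    fin : Carrier → Γ∞
    ∞   : Γ∞

  data _≤∞_ : Γ∞ → Γ∞ → Set where
    fin≤fin : ∀ {a b} → a ≤ b → fin a ≤∞ fin b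
    _≤∞∞    : ∀ x → x ≤∞ ∞

  _+∞_ : Γ∞ → Γ∞ → Γ∞
  fin a +∞ fin b = fin (a + b)
  _     +∞ _     = ∞

record Valuation (K : Field) (G : OrderedAbelianGroup) : Set₁ where
  open Field K
  field
    v      : Carrier → Γ∞ G
    v-cong : ∀ {x y} → x ≈ y → v x ≡ v y
    v-∞    : ∀ x → (v x ≡ ∞) ⇔ (x ≈ 0#)
    v-mul  : ∀ x y → v (x * y) ≡ _+∞_ G (v x) (v y)
    v-add  : ∀ x y → _≤∞_ G (v x) (v (x + y)) ⊎ _≤∞_ G (v y) (v (x + y))
    v-onto : ∀ γ → ∃ λ x → v x ≡ fin γ

-- Polynomials in K[x], as coefficient lists (constant term first),
-- and subsets of K / of K[x] as predicates.

module Setup {K : Field} {G : OrderedAbelianGroup} (val : Valuation K G) where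
  open Field K
  open Valuation val
  open OrderedAbelianGroup G using () renaming (Carrier to Γ; 0# to 0Γ)

  Poly : Set
  Poly = List Carrier

  eval : Poly → Carrier → Carrier
  eval []       s = 0#
  eval (a ∷ as) s = a + s * eval as s

  scale : Carrier → Poly → Poly
  scale c = map (c *_)

  Subset : Set₁
  Subset = Carrier → Set

  PolySet : Set₁
  PolySet = Poly → Set

  _⊆_ : Subset → Subset → Set
  T ⊆ S = ∀ s → T s → S s

  InV : Carrier → Set
  InV x = _≤∞_ G (fin 0Γ) (v x)

  Int : Subset → Poly → Set
  Int T f = ∀ t → T t → InV (eval f t)

  Closure : PolySet → Subset → Subset
  Closure 𝓕 T s = ∀ f → 𝓕 f → Int T f → InV (eval f s)

  -- T is V-polynomially dense in S relative to 𝓕 (T ⊆ S assumed separately)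
  PolyDense : PolySet → Subset → Subset → Set
  PolyDense 𝓕 T S = S ⊆ Closure 𝓕 T

  LowerBound : Γ∞ G → Poly → Subset → Set
  LowerBound γ f T = ∀ t → T t → _≤∞_ G γ (v (eval f t))

  -- Condition (1): for all f ∈ 𝓕, inf_{t∈T} v(f(t)) = inf_{s∈S} v(f(s)),
  -- expressed as equality of the sets of lower bounds in Γ ∪ {∞}.
  SameMin : PolySet → Subset → Subset → Set
  SameMin 𝓕 T S = ∀ f → 𝓕 f → ∀ γ → LowerBound γ f T ⇔ LowerBound γ f S

  ScaleClosed : PolySet → Set
  ScaleClosed 𝓕 = ∀ c → ¬ (c ≈ 0#) → ∀ f → 𝓕 f → 𝓕 (scale c f)

  Nontrivial : Set
  Nontrivial = ∃ λ x → ¬ InV x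

-- The lower bounds γ of v∘f on a set are read off by rescaling: if v(c) = −γ
-- then γ ≤ v(f(t)) for all t ∈ T says exactly that c·f ∈ Int(T, V), and
-- density transfers this to S.  The bound γ = ∞ (f vanishes on T) needs the
-- non-triviality of v: if f(s) ≠ 0, rescale f so that f(s) becomes an element
-- outside V, contradicting density.
module Submission where

open import Defs
open import Data.Product using (_×_; _,_; ∃)
open import Data.List using ([]; _∷_)
open import Data.Empty using (⊥-elim)
open import Relation.Nullary using (¬_)
open import Relation.Binary.PropositionalEquality as ≡ using (_≡_)
open import Function.Bundles using (_⇔_; mk⇔; Equivalence)
import Relation.Binary.Reasoning.Setoid as SetoidReasoning
import Algebra.Properties.CommutativeSemigroup as CommutativeSemigroupProperties

module OrderedAbelianGroupProperties (G : OrderedAbelianGroup) where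
  open OrderedAbelianGroup G

  -‿inverseʳ : ∀ a → a + (- a) ≡ 0#
  -‿inverseʳ a = ≡.trans (+-comm a (- a)) (-‿inverseˡ a)

  -+-cancelʳ : ∀ g a → ((- g) + a) + g ≡ a
  -+-cancelʳ g a = begin
    ((- g) + a) + g ≡⟨ ≡.cong (_+ g) (+-comm (- g) a) ⟩
    (a + (- g)) + g ≡⟨ +-assoc a (- g) g ⟩
    a + ((- g) + g) ≡⟨ ≡.cong (a +_) (-‿inverseˡ g) ⟩
    a + 0#          ≡⟨ +-comm a 0# ⟩
    0# + a          ≡⟨ +-identityˡ a ⟩
    a               ∎
    where open ≡.≡-Reasoning

  0≤-+⇔fin≤ : ∀ g y → _≤∞_ G (fin 0#) (_+∞_ G (fin (- g)) y) ⇔ _≤∞_ G (fin g) y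
  0≤-+⇔fin≤ g y = mk⇔ (to y) (from y)
    where
    to : ∀ y → _≤∞_ G (fin 0#) (_+∞_ G (fin (- g)) y) → _≤∞_ G (fin g) y
    to (fin a) (fin≤fin 0≤-g+a) = fin≤fin
      (≡.subst₂ _≤_ (+-identityˡ g) (-+-cancelʳ g a) (+-mono-≤ g 0≤-g+a))
    to ∞       _                = _ ≤∞∞

    from : ∀ y → _≤∞_ G (fin g) y → _≤∞_ G (fin 0#) (_+∞_ G (fin (- g)) y)
    from (fin a) (fin≤fin g≤a) = fin≤fin
      (≡.subst₂ _≤_ (-‿inverseʳ g) (+-comm a (- g)) (+-mono-≤ (- g) g≤a))
    from ∞       _             = _ ≤∞∞

  ∞≤⇒≡∞ : ∀ {y} → _≤∞_ G ∞ y → y ≡ ∞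
  ∞≤⇒≡∞ (_ ≤∞∞) = ≡.refl

module FieldProperties (K : Field) where
  open Field K
  open SetoidReasoning setoid

  ∃-nonzero-multiplier : ∀ {x y} → ¬ (x ≈ 0#) → ¬ (y ≈ 0#) → ∃ λ c → ¬ (c ≈ 0#) × (c * y ≈ x)
  ∃-nonzero-multiplier {x} {y} x≉0 y≉0 with inverse y y≉0
  ... | y⁻¹ , yy⁻¹≈1 = x * y⁻¹ , c≉0 , cy≈x
    where
    cy≈x : (x * y⁻¹) * y ≈ x
    cy≈x = begin
      (x * y⁻¹) * y ≈⟨ *-assoc x y⁻¹ y ⟩
      x * (y⁻¹ * y) ≈⟨ *-congˡ (*-comm y⁻¹ y) ⟩
      x * (y * y⁻¹) ≈⟨ *-congˡ yy⁻¹≈1 ⟩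
      x * 1#        ≈⟨ *-identityʳ x ⟩
      x             ∎

    c≉0 : ¬ (x * y⁻¹ ≈ 0#)
    c≉0 c≈0 = x≉0 (begin
      x             ≈⟨ sym cy≈x ⟩
      (x * y⁻¹) * y ≈⟨ *-congʳ c≈0 ⟩
      0# * y        ≈⟨ zeroˡ y ⟩
      0#            ∎)

module ValuationProperties {K : Field} {G : OrderedAbelianGroup} (val : Valuation K G) where
  open Field K
  open Valuation val
  open Setup val
  open OrderedAbelianGroup G using () renaming (0# to 0Γ; -_ to ⊝_)
  open OrderedAbelianGroupProperties G

  InV-cong : ∀ {x y} → x ≈ y → InV x → InV y
  InV-cong x≈y = ≡.subst (_≤∞_ G (fin 0Γ)) (v-cong x≈y)

  InV-≈0 : ∀ {x} → x ≈ 0# → InV x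
  InV-≈0 {x} x≈0 =
    ≡.subst (_≤∞_ G (fin 0Γ)) (≡.sym (Equivalence.from (v-∞ x) x≈0)) (fin 0Γ ≤∞∞)

  v≡fin⇒≉0 : ∀ {x a} → v x ≡ fin a → ¬ (x ≈ 0#)
  v≡fin⇒≉0 {x} vx≡a x≈0 with ≡.trans (≡.sym vx≡a) (Equivalence.from (v-∞ x) x≈0)
  ... | ()

  ∞≤⇒≈0 : ∀ {x} → _≤∞_ G ∞ (v x) → x ≈ 0#
  ∞≤⇒≈0 {x} ∞≤vx = Equivalence.to (v-∞ x) (∞≤⇒≡∞ ∞≤vx)

  InV-*⇔fin≤ : ∀ {c g} → v c ≡ fin (⊝ g) → ∀ y → InV (c * y) ⇔ _≤∞_ G (fin g) (v y)
  InV-*⇔fin≤ {c} {g} vc≡-g y rewrite v-mul c y | vc≡-g = 0≤-+⇔fin≤ g (v y)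

module Density {K : Field} {G : OrderedAbelianGroup} (val : Valuation K G) where
  open Field K
  open Valuation val
  open Setup val
  open OrderedAbelianGroup G using () renaming (0# to 0Γ; -_ to ⊝_)
  open FieldProperties K
  open ValuationProperties val
  open CommutativeSemigroupProperties *-commutativeSemigroup using (x∙yz≈y∙xz)

  eval-scale : ∀ c f s → eval (scale c f) s ≈ c * eval f s
  eval-scale c []       s = sym (zeroʳ c)
  eval-scale c (a ∷ as) s = begin
    c * a + s * eval (scale c as) s ≈⟨ +-congˡ (*-congˡ (eval-scale c as s)) ⟩
    c * a + s * (c * eval as s)     ≈⟨ +-congˡ (x∙yz≈y∙xz s c (eval as s)) ⟩
    c * a + c * (s * eval as s)     ≈⟨ sym (distribˡ c a (s * eval as s)) ⟩
    c * (a + s * eval as s)         ∎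
    where open SetoidReasoning setoid

  LowerBound-fin⇔Int-scale : ∀ {c g} → v c ≡ fin (⊝ g) → ∀ f T →
                             LowerBound (fin g) f T ⇔ Int T (scale c f)
  LowerBound-fin⇔Int-scale {c} vc≡-g f T = mk⇔
    (λ lb t Tt → InV-cong (sym (eval-scale c f t)) (Equivalence.from (InV-*⇔fin≤ vc≡-g _) (lb t Tt)))
    (λ int t Tt → Equivalence.to (InV-*⇔fin≤ vc≡-g _) (InV-cong (eval-scale c f t) (int t Tt)))

  LowerBound-∞⇒Int-scale : ∀ c f T → LowerBound ∞ f T → Int T (scale c f)
  LowerBound-∞⇒Int-scale c f T lb t Tt = InV-≈0 (begin
    eval (scale c f) t ≈⟨ eval-scale c f t ⟩
    c * eval f t       ≈⟨ *-congˡ (∞≤⇒≈0 (lb t Tt)) ⟩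
    c * 0#             ≈⟨ zeroʳ c ⟩
    0#                 ∎)
    where open SetoidReasoning setoid

  module _ {T S : Subset} {𝓕 : PolySet} where

    SameMin⇒PolyDense : SameMin 𝓕 T S → PolyDense 𝓕 T S
    SameMin⇒PolyDense sameMin s Ss f f∈𝓕 f∈Int = Equivalence.to (sameMin f f∈𝓕 (fin 0Γ)) f∈Int s Ss

    module _ (scaleClosed : ScaleClosed 𝓕) (dense : PolyDense 𝓕 T S) {f : Poly} (f∈𝓕 : 𝓕 f) where

      PolyDense⇒InV-scale : ∀ {c} → ¬ (c ≈ 0#) → Int T (scale c f) → ∀ s → S s → InV (c * eval f s)
      PolyDense⇒InV-scale {c} c≉0 cf∈Int s Ss =
        InV-cong (eval-scale c f s) (dense s Ss (scale c f) (scaleClosed c c≉0 f f∈𝓕) cf∈Int)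

      PolyDense⇒LowerBound-fin : ∀ g → LowerBound (fin g) f T → LowerBound (fin g) f S
      PolyDense⇒LowerBound-fin g lb s Ss with v-onto (⊝ g)
      ... | c , vc≡-g = Equivalence.to (InV-*⇔fin≤ vc≡-g _)
        (PolyDense⇒InV-scale (v≡fin⇒≉0 vc≡-g) (Equivalence.to (LowerBound-fin⇔Int-scale vc≡-g f T) lb) s Ss)

      PolyDense⇒LowerBound-∞ : Nontrivial → LowerBound ∞ f T → LowerBound ∞ f S
      PolyDense⇒LowerBound-∞ (x , x∉V) lb s Ss with v (eval f s) in vfs≡
      ... | ∞     = ∞ ≤∞∞
      ... | fin _ with ∃-nonzero-multiplier (λ x≈0 → x∉V (InV-≈0 x≈0)) (v≡fin⇒≉0 vfs≡)
      ...   | c , c≉0 , cfs≈x =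
        ⊥-elim (x∉V (InV-cong cfs≈x (PolyDense⇒InV-scale c≉0 (LowerBound-∞⇒Int-scale c f T lb) s Ss)))

    PolyDense⇒SameMin : T ⊆ S → ScaleClosed 𝓕 → Nontrivial → PolyDense 𝓕 T S → SameMin 𝓕 T S
    PolyDense⇒SameMin T⊆S scaleClosed nontrivial dense f f∈𝓕 γ = mk⇔ (to γ) (λ lb t Tt → lb t (T⊆S t Tt))
      where
      to : ∀ γ → LowerBound γ f T → LowerBound γ f S
      to (fin g) = PolyDense⇒LowerBound-fin scaleClosed dense f∈𝓕 g
      to ∞       = PolyDense⇒LowerBound-∞ scaleClosed dense f∈𝓕 nontrivial

lemma2p3 : (K : Field) (G : OrderedAbelianGroup) (val : Valuation K G)
    → let open Setup val in
    (T S : Subset) (𝓕 : PolySet) → T ⊆ S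
    → (SameMin 𝓕 T S → PolyDense 𝓕 T S)
    × (ScaleClosed 𝓕 → Nontrivial → PolyDense 𝓕 T S → SameMin 𝓕 T S)
lemma2p3 K G val T S 𝓕 T⊆S = SameMin⇒PolyDense , PolyDense⇒SameMin T⊆S
  where open Density val
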